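{- Let $T[0..n)$ be a text whose last character is a terminator $\$$ that occurs nowhere else in $T$, and let $P[0..m)$ be a pattern. Let $\mathsf{eMS}$ be the extended matching statistics of $P$ with respect to $T$, and let $i\in[0..m)$ be such that $w = P[i..i+\mathsf{eMS}[i].\mathsf{len}) = T[\mathsf{eMS}[i].\mathsf{pos}..\mathsf{eMS}[i].\mathsf{pos}+\mathsf{eMS}[i].\mathsf{len})$ is a maximal match between $P$ and $T$. Then $w$ occurs exactly once in $T$ if and only if $\mathsf{eMS}[i].\mathsf{twice} < \mathsf{eMS}[i].\mathsf{len}$.
   Context: Strings are indexed from $0$; $S[i..j)=S[i]S[i+1]\cdots S[j-1]$ (empty if $i\ge j$). The terminator $\$$ is lexicographically smaller than every other character. A match is a pair $(i,\ell)$ such that the factor $P[i..i+\ell)$ occurs in $T$; it is maximal if it cannot be extended on either side: either $i=0$ or $P[i-1..i+\ell)$ does not occur in $T$, and either $i=m-\ell$ or $P[i..i+\ell+1)$ does not occur in $T$. The extended matching statistics $\mathsf{eMS}[0..m)$ is an array of triples $(\mathsf{pos},\mathsf{len},\mathsf{twice})$ such that for each $i$: $P[i..i+\mathsf{eMS}[i].\mathsf{len}) = T[\mathsf{eMS}[i].\mathsf{pos}..\mathsf{eMS}[i].\mathsf{pos}+\mathsf{eMS}[i].\mathsf{len})$; either $i=m-\mathsf{eMS}[i].\mathsf{len}$ or $P[i..i+\mathsf{eMS}[i].\mathsf{len}+1)$ does not occur in $T$ (so $\mathsf{len}$ is the length of the longest prefix of $P[i..m)$ occurring in $T$ and $\mathsf{pos}$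 is the starting position in $T$ of one occurrence of it); and $\mathsf{eMS}[i].\mathsf{twice}$ is the largest $\ell$ for which there exists a position $p\neq \mathsf{eMS}[i].\mathsf{pos}$ with $P[i..i+\ell)=T[p..p+\ell)$. -}

module Defs where

open import Data.Nat using (ℕ; zero; suc; _+_; _∸_; _≤_; _<_)
open import Data.Product using (Σ; ∃; _×_; _,_)
open import Data.Sum using (_⊎_)
open import Relation.Binary.PropositionalEquality using (_≡_; _≢_)
open import Relation.Nullary using (¬_)

-- A string of length n over alphabet A: the character at index k < n is S k.
-- (Values of S at indices ≥ n are never inspected by the definitions below.)
Str : Set → Set
Str A = ℕ → A

OccAt : {A : Set} (n : ℕ) (T : Str A) (m : ℕ) (P : Str A)
        (i ℓ p : ℕ) → Set
OccAt n T m P i ℓ p =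
  (i + ℓ ≤ m) × (p + ℓ ≤ n) × (∀ k → k < ℓ → T (p + k) ≡ P (i + k))

Occurs : {A : Set} (n : ℕ) (T : Str A) (m : ℕ) (P : Str A) (i ℓ : ℕ) → Set
Occurs n T m P i ℓ = ∃ λ p → OccAt n T m P i ℓ p

MaximalMatch : {A : Set} (n : ℕ) (T : Str A) (m : ℕ) (P : Str A) (i ℓ : ℕ) → Set
MaximalMatch n T m P i ℓ =
  Occurs n T m P i ℓ
  × ((i ≡ 0) ⊎ (Σ ℕ λ i' → (i ≡ suc i') × ¬ Occurs n T m P i' (suc ℓ)))
  × ((i ≡ m ∸ ℓ) ⊎ ¬ Occurs n T m P i (suc ℓ))

record Triple : Set where
  constructor triple
  field
    pos len twice : ℕ
open Triple public

IsEMSEntry : {A : Set} (n : ℕ) (T : Str A) (m : ℕ) (P : Str A)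
             (i : ℕ) (e : Triple) → Set
IsEMSEntry n T m P i e =
  OccAt n T m P i (len e) (pos e)
  × ((i ≡ m ∸ len e) ⊎ ¬ Occurs n T m P i (suc (len e)))
  × (Σ ℕ λ p → (p ≢ pos e) × OccAt n T m P i (twice e) p)
  × (∀ ℓ p → p ≢ pos e → OccAt n T m P i ℓ p → ℓ ≤ twice e)

IsEMS : {A : Set} (n : ℕ) (T : Str A) (m : ℕ) (P : Str A) (eMS : ℕ → Triple) → Set
IsEMS n T m P eMS = ∀ i → i < m → IsEMSEntry n T m P i (eMS i)

OccursOnce : {A : Set} (n : ℕ) (T : Str A) (m : ℕ) (P : Str A) (i ℓ : ℕ) → Set
OccursOnce n T m P i ℓ =
  Σ ℕ λ p → OccAt n T m P i ℓ p × (∀ q → OccAt n T m P i ℓ q → q ≡ p)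

TerminatedBy : {A : Set} (n : ℕ) (T : Str A) (dollar : A) → Set
TerminatedBy n T dollar =
  Σ ℕ λ n' → (n ≡ suc n') × (T n' ≡ dollar) × (∀ k → k < n' → T k ≢ dollar)

-- The triple records an occurrence of w at pos, and twice is the longest
-- prefix of P[i..m) occurring at some other position. If twice < len, no
-- other position can carry w, so the occurrence is unique; if twice ≥ len,
-- the prefix of length len of the second occurrence is a second copy of w.
module Submission where

open import Defs
open import Data.Nat using (ℕ; _+_; _<_; _≤_; _<?_)
open import Data.Nat.Properties using (≤-trans; <-≤-trans; +-monoʳ-≤; ≮⇒≥; ≤⇒≯; _≟_)
open import Data.Product using (Σ; _×_; _,_)
open import Function.Bundles using (_⇔_; mk⇔)
open import Relation.Binary.PropositionalEquality using (_≡_; _≢_; sym; trans)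
open import Relation.Nullary using (yes; no; contradiction)

OccAt-prefix : {A : Set} (n : ℕ) (T : Str A) (m : ℕ) (P : Str A) {i ℓ ℓ' p : ℕ} →
               ℓ' ≤ ℓ → OccAt n T m P i ℓ p → OccAt n T m P i ℓ' p
OccAt-prefix _ _ _ _ {i} {p = p} ℓ'≤ℓ (i+ℓ≤m , p+ℓ≤n , agree) =
  ≤-trans (+-monoʳ-≤ i ℓ'≤ℓ) i+ℓ≤m ,
  ≤-trans (+-monoʳ-≤ p ℓ'≤ℓ) p+ℓ≤n ,
  λ k k<ℓ' → agree k (<-≤-trans k<ℓ' ℓ'≤ℓ)

module _ {A : Set} (n : ℕ) (T : Str A) (m : ℕ) (P : Str A) (i : ℕ) {e : Triple}
         (occ : OccAt n T m P i (len e) (pos e)) where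

  twice<len⇒OccursOnce :
    (∀ ℓ p → p ≢ pos e → OccAt n T m P i ℓ p → ℓ ≤ twice e) →
    twice e < len e → OccursOnce n T m P i (len e)
  twice<len⇒OccursOnce twice-max twice<len = pos e , occ , unique
    where
    unique : ∀ q → OccAt n T m P i (len e) q → q ≡ pos e
    unique q occ-q with q ≟ pos e
    ... | yes q≡pos = q≡pos
    ... | no  q≢pos = contradiction twice<len (≤⇒≯ (twice-max (len e) q q≢pos occ-q))

  OccursOnce⇒twice<len :
    (Σ ℕ λ p → (p ≢ pos e) × OccAt n T m P i (twice e) p) →
    OccursOnce n T m P i (len e) → twice e < len e
  OccursOnce⇒twice<len (p , p≢pos , occ-p) (q , _ , unique) with twice e <? len e
  ... | yes twice<len = twice<len
  ... | no  twice≮len = contradiction p≡pos p≢pos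
    where
    p≡pos : p ≡ pos e
    p≡pos = trans (unique p (OccAt-prefix n T m P (≮⇒≥ twice≮len) occ-p)) (sym (unique (pos e) occ))

OccursOnce⇔twice<len : {A : Set} (n : ℕ) (T : Str A) (m : ℕ) (P : Str A) (i : ℕ) {e : Triple} →
                       IsEMSEntry n T m P i e →
                       OccursOnce n T m P i (len e) ⇔ (twice e < len e)
OccursOnce⇔twice<len n T m P i (occ , _ , second , twice-max) =
  mk⇔ (OccursOnce⇒twice<len n T m P i occ second) (twice<len⇒OccursOnce n T m P i occ twice-max)

lemma1 : {A : Set} (dollar : A) (n : ℕ) (T : Str A) (m : ℕ) (P : Str A)
         (eMS : ℕ → Triple) (i : ℕ) →
         TerminatedBy n T dollar →
         IsEMS n T m P eMS →
         i < m →
         MaximalMatch n T m P i (len (eMS i)) →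
         OccursOnce n T m P i (len (eMS i)) ⇔ (twice (eMS i) < len (eMS i))
lemma1 _ n T m P eMS i _ ems i<m _ = OccursOnce⇔twice<len n T m P i (ems i i<m)
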